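{- Let $G$ be a strongly connected unweighted directed graph on vertex set $V$ that undergoes a sequence of edge insertions only, or edge deletions only (remaining strongly connected); let $G_\tau$ denote the graph at time $\tau$. Let $S_1\subseteq V$ be a fixed set of size $n_p$, let $t\ge t_0$ be two time instances, let $a\in V$, and let $S_2=N^{in}_{t_0}(a,n_q)$. Let $\ell_0=\max_{v\in V}d_{G_{t_0}}(S_1,v)$ and let $\epsilon\in[0,1/2]$ be such that both $\max_{v\in V}d_{G_t}(S_1,v)$ and $d_{G_t}(S_1,a)$ lie in $[\ell_0(1-\epsilon),\ell_0(1+\epsilon)]$. Suppose $S_1\cap S_2\neq\emptyset$ and that (i) in the edge-deletions case, $d_{G_{t_0}}(S_1,a)\ge(1-\epsilon)\ell_0$; (ii) in the edge-insertions case, $\mathrm{InEcc}_t(a)\ge(1-\epsilon)\mathrm{InEcc}_{t_0}(a)$. Then for any $p,q>0$ with $p+q=1$, at time $t$ either $d_{G_t}(S_1,x)\le\lfloor(p+2\epsilon)\mathrm{InEcc}_t(a)\rfloor$ for all $x\in V$, or $d_{G_t}(x,S_2)\le\lceil(q+2\epsilon)\mathrm{InEcc}_t(a)\rceil$ for all $x\in V$.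
   Context: $d_{G}(u,v)$ is the number of edges of a shortest $u$-to-$v$ path in $G$; $d_G(A,x)=\min_{v\in A}d_G(v,x)$, $d_G(x,A)=\min_{v\in A}d_G(x,v)$. $\mathrm{InEcc}_\tau(a)=\max_{v\in V}d_{G_\tau}(v,a)$. $N^{in}_\tau(a,\ell)$ denotes a set of $\ell$ vertices $v$ with the smallest values $d_{G_\tau}(v,a)$ (ties broken arbitrarily), i.e. the $\ell$ closest incoming vertices of $a$ at time $\tau$.
   Formalization: The parameters ε, p and q range over the rationals. -}

module Defs where

open import Data.Nat using (ℕ; zero; suc; _⊔_; _⊓_)
open import Data.Bool using (Bool; true; false; _∨_; _∧_; if_then_else_)
open import Data.Fin using (Fin)
open import Data.Fin.Properties using (_≟_)
open import Data.Fin.Subset using (Subset; inside; outside; ∣_∣; _∈_; _∉_)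
open import Data.Vec using (lookup)
open import Data.List using (List; foldr; map)
open import Data.Bool.ListAction using (any)
open import Data.List.Base using (allFin)
open import Data.Product using (∃; _×_)
open import Data.Nat using (_≤_)
open import Data.Integer using (+_)
open import Data.Rational using (ℚ; _/_)
open import Relation.Binary.PropositionalEquality using (_≡_)
open import Relation.Nullary.Decidable using (⌊_⌋)

-- A directed graph on vertex set V = Fin n, given by its adjacency relation:
-- G u v ≡ true  iff  there is an edge u → v.
Graph : ℕ → Set
Graph n = Fin n → Fin n → Bool

data Walk {n : ℕ} (G : Graph n) : Fin n → Fin n → ℕ → Set where
  here : ∀ {u} → Walk G u u 0
  step : ∀ {u w v k} → G u w ≡ true → Walk G w v k → Walk G u v (suc k)

StronglyConnected : ∀ {n} → Graph n → Set
StronglyConnected {n} G = ∀ (u v : Fin n) → ∃ λ k → Walk G u v k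

reachWithin : ∀ {n} → Graph n → ℕ → Fin n → Fin n → Bool
reachWithin G zero    u v = ⌊ u ≟ v ⌋
reachWithin {n} G (suc k) u v =
  reachWithin G k u v ∨ any (λ w → G u w ∧ reachWithin G k w v) (allFin n)

search : (ℕ → Bool) → ℕ → ℕ → ℕ
search f j zero       = j
search f j (suc fuel) = if f j then j else search f (suc j) fuel

-- d_G(u,v): number of edges of a shortest u-to-v walk.  (In a graph on n
-- vertices any reachable vertex is reachable within n-1 edges; the default
-- value n for unreachable pairs never occurs for strongly connected graphs.)
dist : ∀ {n} → Graph n → Fin n → Fin n → ℕ
dist {n} G u v = search (λ k → reachWithin G k u v) 0 n

minOver : ∀ {n} → (Fin n → ℕ) → ℕ
minOver {n} f = foldr _⊓_ n (map f (allFin n))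

maxOver : ∀ {n} → (Fin n → ℕ) → ℕ
maxOver {n} f = foldr _⊔_ 0 (map f (allFin n))

-- minimum of f over a subset A (vertices outside A contribute the default n,
-- which exceeds every distance in a strongly connected graph)
minIn : ∀ {n} → Subset n → (Fin n → ℕ) → ℕ
minIn {n} A f = minOver (λ v → restrict (lookup A v) (f v))
  where
  restrict : _ → ℕ → ℕ
  restrict inside  x = x
  restrict outside _ = n

distFrom : ∀ {n} → Graph n → Subset n → Fin n → ℕ
distFrom G A x = minIn A (λ v → dist G v x)

distTo : ∀ {n} → Graph n → Fin n → Subset n → ℕ
distTo G x A = minIn A (λ v → dist G x v)

InEcc : ∀ {n} → Graph n → Fin n → ℕ
InEcc G a = maxOver (λ v → dist G v a)

maxDistFrom : ∀ {n} → Graph n → Subset n → ℕ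
maxDistFrom G A = maxOver (λ v → distFrom G A v)

_⊆ₑ_ : ∀ {n} → Graph n → Graph n → Set
_⊆ₑ_ {n} G H = ∀ (u v : Fin n) → G u v ≡ true → H u v ≡ true

data Mode : Set where
  insertions deletions : Mode

MonoStep : ∀ {n} → Mode → Graph n → Graph n → Set
MonoStep insertions G H = G ⊆ₑ H
MonoStep deletions  G H = H ⊆ₑ G

record Dynamic {n : ℕ} (mode : Mode) (G : ℕ → Graph n) : Set where
  field
    stronglyConnected : ∀ τ → StronglyConnected (G τ)
    monotone          : ∀ τ → MonoStep mode (G τ) (G (suc τ))

-- S is a valid choice of N^in_G(a, ℓ): ℓ vertices with the smallest d_G(v,a)
-- (ties broken arbitrarily).
IsNin : ∀ {n} → Graph n → Fin n → ℕ → Subset n → Set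
IsNin G a ℓ S = ∣ S ∣ ≡ ℓ × (∀ v w → v ∈ S → w ∉ S → dist G v a ≤ dist G w a)

ℕtoℚ : ℕ → ℚ
ℕtoℚ k = + k / 1

-- Let D = InEcc_t(a), ℓ = max_v d_t(S₁,v).  If ℓ ≤ (p+2ε)D the first
-- alternative holds.  Otherwise pick y ∈ S₁ ∩ S₂, put r = d_{t₀}(y,a), and let
-- H be the sparser of G_{t₀}, G_t (a subgraph of both).  Walking a shortest
-- H-path from x towards a, the vertex r-1 steps before a is closer to a than
-- y at time t₀, hence lies in S₂; so d_t(x,S₂) + r ≤ InEcc_H(a) + 1.  The
-- hypotheses on ε give InEcc_H(a) < r + (q+2ε)D (a computation in ℚ, separate
-- for the two modes), and the second alternative follows.

module Submission where

module Graphs where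

  open import Defs
  open import Data.Nat using (ℕ; zero; suc; _+_; _∸_; _≤_; _<_; _⊔_; _⊓_; z≤n; s≤s; _≤′_; ≤′-refl; ≤′-step)
  import Data.Nat.Properties as ℕ
  open import Data.Bool using (Bool; true; false; T; _∨_; _∧_)
  open import Data.Bool.ListAction using (or)
  open import Data.Bool.Properties using (T-≡; T-∨; T-∧)
  open import Data.Fin as Fin using (Fin)
  open import Data.Fin.Subset using (Subset; ∣_∣; _∈_; inside; outside)
  open import Data.Fin.Subset.Properties using (_∈?_; ∣p∣≤n)
  open import Data.Vec using (lookup; tabulate) renaming (_∷_ to _∷ᵥ_)
  open import Data.Vec.Properties using (lookup⇒[]=; []=⇒lookup; tabulate-cong)
  open import Data.List using ([]; _∷_; foldr; map; allFin)
  open import Data.List.Properties using (map-cong)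
  open import Data.List.Relation.Unary.Any using (here; there; satisfied)
  open import Data.List.Relation.Unary.Any.Properties using (any⁺; any⁻)
  open import Data.List.Membership.Propositional using (lose) renaming (_∈_ to _∈ₗ_)
  open import Data.List.Membership.Propositional.Properties using (∈-allFin)
  open import Data.Product using (∃-syntax; _×_; _,_; proj₁; proj₂)
  open import Data.Sum using (_⊎_; inj₁; inj₂)
  open import Data.Empty using (⊥-elim)
  open import Function using (_∘_; Equivalence)
  open import Relation.Nullary using (yes; no; contradiction)
  open import Relation.Nullary.Decidable using (fromWitness; toWitness)
  open import Relation.Binary.PropositionalEquality using (_≡_; refl; sym; trans; cong; cong₂; subst)

  open Equivalence using (to; from)

  Reach : ∀ {n} → Graph n → ℕ → Fin n → Fin n → Set
  Reach G k u v = T (reachWithin G k u v)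

  module _ {n : ℕ} (G : Graph n) where

    walk⇒reach : ∀ {u v k} → Walk G u v k → Reach G k u v
    walk⇒reach here = fromWitness refl
    walk⇒reach (step {w = w} e walk) =
      from T-∨ (inj₂ (any⁺ _ (lose (∈-allFin w) (from T-∧ (from T-≡ e , walk⇒reach walk)))))

    reach⇒walk : ∀ k {u v} → Reach G k u v → ∃[ j ] j ≤ k × Walk G u v j
    reach⇒walk zero r with toWitness r
    ... | refl = 0 , z≤n , here
    reach⇒walk (suc k) {u} r with to T-∨ r
    ... | inj₁ r′ = let j , j≤k , walk = reach⇒walk k r′ in j , ℕ.m≤n⇒m≤1+n j≤k , walk
    ... | inj₂ r′ with satisfied (any⁻ _ (allFin n) r′)
    ...   | w , uw-then-reach with to T-∧ uw-then-reach
    ...     | e , r″ = let j , j≤k , walk = reach⇒walk k r″ in suc j , s≤s j≤k , step (to T-≡ e) walk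

    reach-suc : ∀ k u v → Reach G k u v → Reach G (suc k) u v
    reach-suc k u v r = from T-∨ (inj₁ r)

    reach-mono : ∀ {k k′} u v → k ≤′ k′ → Reach G k u v → Reach G k′ u v
    reach-mono u v ≤′-refl                 r = r
    reach-mono u v (≤′-step {k′} k≤k′) r = reach-suc k′ u v (reach-mono u v k≤k′ r)

  count-grows : ∀ {m} (f g : Fin m → Bool) → (∀ u → T (f u) → T (g u)) →
                (∀ u → f u ≡ g u) ⊎ ∣ tabulate f ∣ < ∣ tabulate g ∣
  count-grows {zero} f g f⇒g = inj₁ (λ ())
  count-grows {suc m} f g f⇒g with count-grows (f ∘ Fin.suc) (g ∘ Fin.suc) (f⇒g ∘ Fin.suc)
  ... | inj₂ tail< = inj₂ (cons< (f Fin.zero) (g Fin.zero) (tabulate (f ∘ Fin.suc)) (tabulate (g ∘ Fin.suc)) (f⇒g Fin.zero) tail<)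
    where
    cons< : ∀ a b (p q : Subset m) → (T a → T b) → ∣ p ∣ < ∣ q ∣ → ∣ a ∷ᵥ p ∣ < ∣ b ∷ᵥ q ∣
    cons< true  true  _ _ _   lt = s≤s lt
    cons< false true  _ _ _   lt = ℕ.m<n⇒m<1+n lt
    cons< false false _ _ _   lt = lt
    cons< true  false _ _ a⇒b _  = ⊥-elim (a⇒b _)
  ... | inj₁ same with f Fin.zero in f0 | g Fin.zero in g0 | f⇒g Fin.zero
  ...   | true  | true  | _   = inj₁ λ { Fin.zero → trans f0 (sym g0) ; (Fin.suc u) → same u }
  ...   | false | false | _   = inj₁ λ { Fin.zero → trans f0 (sym g0) ; (Fin.suc u) → same u }
  ...   | false | true  | _   = inj₂ (s≤s (ℕ.≤-reflexive (cong ∣_∣ (tabulate-cong same))))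
  ...   | true  | false | f⇒g₀ = ⊥-elim (f⇒g₀ _)

  count-pos : ∀ {m} (f : Fin m → Bool) u → T (f u) → 0 < ∣ tabulate f ∣
  count-pos f Fin.zero fu with f Fin.zero
  ... | true = s≤s z≤n
  count-pos f (Fin.suc u) fu with f Fin.zero
  ... | true  = s≤s z≤n
  ... | false = count-pos (f ∘ Fin.suc) u fu

  -- The sets of vertices reaching v within k steps grow with k; once two
  -- consecutive ones agree they agree forever (reachWithin at k+1 is computed
  -- from reachWithin at k), and as each strict growth adds a vertex, this
  -- happens before step n.  Hence every reachable vertex reaches v within n-1 steps.
  module Stabilisation {n : ℕ} (G : Graph n) (v : Fin n) where

    ball : ℕ → Fin n → Bool
    ball k u = reachWithin G k u v

    Stable : ℕ → Set
    Stable k = ∀ u → ball (suc k) u ≡ ball k u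

    stable-suc : ∀ k → Stable k → Stable (suc k)
    stable-suc k st u =
      cong₂ _∨_ (st u) (cong or (map-cong (λ w → cong (G u w ∧_) (st w)) (allFin n)))

    stable-after : ∀ {j} → Stable j → ∀ m → Stable (m + j)
    stable-after     st zero    = st
    stable-after {j} st (suc m) = stable-suc (m + j) (stable-after st m)

    ball-after : ∀ {j} → Stable j → ∀ m u → ball (m + j) u ≡ ball j u
    ball-after st zero    u = refl
    ball-after st (suc m) u = trans (stable-after st m u) (ball-after st m u)

    growth : ∀ k → (∃[ j ] j < k × Stable j) ⊎ k < ∣ tabulate (ball k) ∣
    growth zero = inj₂ (count-pos (ball 0) v (walk⇒reach G here))
    growth (suc k) with growth k
    ... | inj₁ (j , j<k , st) = inj₁ (j , ℕ.m<n⇒m<1+n j<k , st)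
    ... | inj₂ k<size with count-grows (ball k) (ball (suc k)) (λ u → reach-suc G k u v)
    ...   | inj₁ same = inj₁ (k , ℕ.n<1+n k , λ u → sym (same u))
    ...   | inj₂ grew = inj₂ (ℕ.≤-<-trans k<size grew)

    stabilises : ∃[ j ] j < n × Stable j
    stabilises with growth n
    ... | inj₁ found = found
    ... | inj₂ n<size = contradiction (∣p∣≤n (tabulate (ball n))) (ℕ.<⇒≱ n<size)

    reach-within-n : ∀ k u → Reach G k u v → ∃[ j ] j < n × Reach G j u v
    reach-within-n k u r =
      let j , j<n , st = stabilises
      in j , j<n , subst T (ball-after st k u) (reach-mono G u v (ℕ.≤⇒≤′ (ℕ.m≤m+n k j)) r)

  search-≤ : ∀ (f : ℕ → Bool) j fuel k → j ≤ k → T (f k) → search f j fuel ≤ k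
  search-≤ f j zero       k j≤k fk = j≤k
  search-≤ f j (suc fuel) k j≤k fk with f j in fj
  ... | true  = j≤k
  ... | false = search-≤ f (suc j) fuel k (ℕ.≤∧≢⇒< j≤k λ { refl → subst T fj fk }) fk

  search-hit : ∀ (f : ℕ → Bool) j fuel k → j ≤ k → k < j + fuel → T (f k) → T (f (search f j fuel))
  search-hit f j zero       k j≤k k<j+0 fk =
    contradiction (subst (_≤ k) (sym (ℕ.+-identityʳ j)) j≤k) (ℕ.<⇒≱ k<j+0)
  search-hit f j (suc fuel) k j≤k k<j+fuel fk with f j in fj
  ... | true  = subst T (sym fj) _
  ... | false = search-hit f (suc j) fuel k (ℕ.≤∧≢⇒< j≤k λ { refl → subst T fj fk })
                  (subst (k <_) (ℕ.+-suc j fuel) k<j+fuel) fk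

  module _ {n : ℕ} {G : Graph n} where

    dist-≤ : ∀ {u v k} → Walk G u v k → dist G u v ≤ k
    dist-≤ {u} {v} {k} walk = search-≤ (λ i → reachWithin G i u v) 0 n k z≤n (walk⇒reach G walk)

    shortest-walk : StronglyConnected G → ∀ u v → Walk G u v (dist G u v)
    shortest-walk sc u v with reach⇒walk G (dist G u v) reaches
      where
      reaches : Reach G (dist G u v) u v
      reaches =
        let k , walk = sc u v
            j , j<n , r = Stabilisation.reach-within-n G v k u (walk⇒reach G walk)
        in search-hit (λ i → reachWithin G i u v) 0 n j z≤n j<n r
    ... | j , j≤d , walk = subst (Walk G u v) (ℕ.≤-antisym j≤d (dist-≤ walk)) walk

    dist≡0⇒≡ : StronglyConnected G → ∀ {u v} → dist G u v ≡ 0 → u ≡ v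
    dist≡0⇒≡ sc {u} {v} d≡0 = endpoints (subst (Walk G u v) d≡0 (shortest-walk sc u v))
      where
      endpoints : Walk G u v 0 → u ≡ v
      endpoints here = refl

    split-walk : ∀ i {j x z} → Walk G x z (i + j) → ∃[ u ] Walk G x u i × Walk G u z j
    split-walk zero    {x = x} walk = x , here , walk
    split-walk (suc i) (step e walk) =
      let u , prefix , suffix = split-walk i walk in u , step e prefix , suffix

    waypoint : StronglyConnected G → ∀ x z j →
               ∃[ u ] dist G x u ≤ dist G x z ∸ j × dist G u z ≤ j
    waypoint sc x z j =
      let u , prefix , suffix = split-walk (d ∸ j) (subst (Walk G x z) d≡ (shortest-walk sc x z))
      in u , dist-≤ prefix , ℕ.≤-trans (dist-≤ suffix) (ℕ.m⊓n≤m j d)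
      where
      d : ℕ
      d = dist G x z
      d≡ : d ≡ d ∸ j + j ⊓ d
      d≡ = sym (trans (ℕ.+-comm (d ∸ j) (j ⊓ d)) (ℕ.m⊓n+n∸m≡n j d))

  walk-⊆ : ∀ {n} {H G : Graph n} → H ⊆ₑ G → ∀ {u v k} → Walk H u v k → Walk G u v k
  walk-⊆ H⊆G here          = here
  walk-⊆ H⊆G (step e walk) = step (H⊆G _ _ e) (walk-⊆ H⊆G walk)

  dist-⊆ : ∀ {n} {H G : Graph n} → StronglyConnected H → H ⊆ₑ G → ∀ u v → dist G u v ≤ dist H u v
  dist-⊆ sc H⊆G u v = dist-≤ (walk-⊆ H⊆G (shortest-walk sc u v))

  module _ {A : Set} (f : A → ℕ) where

    foldr-⊔-≥ : ∀ {x} xs → x ∈ₗ xs → f x ≤ foldr _⊔_ 0 (map f xs)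
    foldr-⊔-≥ (y ∷ ys) (here refl) = ℕ.m≤m⊔n (f y) _
    foldr-⊔-≥ (y ∷ ys) (there x∈) = ℕ.m≤n⇒m≤o⊔n (f y) (foldr-⊔-≥ ys x∈)

    foldr-⊓-≤ : ∀ d {x} xs → x ∈ₗ xs → foldr _⊓_ d (map f xs) ≤ f x
    foldr-⊓-≤ d (y ∷ ys) (here refl) = ℕ.m⊓n≤m (f y) _
    foldr-⊓-≤ d (y ∷ ys) (there x∈) = ℕ.m≤n⇒o⊓m≤n (f y) (foldr-⊓-≤ d ys x∈)

    foldr-⊓-≤-default : ∀ d xs → foldr _⊓_ d (map f xs) ≤ d
    foldr-⊓-≤-default d []       = ℕ.≤-refl
    foldr-⊓-≤-default d (y ∷ ys) = ℕ.m≤n⇒o⊓m≤n (f y) (foldr-⊓-≤-default d ys)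

    foldr-⊓-attained : ∀ d xs → foldr _⊓_ d (map f xs) ≡ d ⊎ ∃[ x ] foldr _⊓_ d (map f xs) ≡ f x
    foldr-⊓-attained d []       = inj₁ refl
    foldr-⊓-attained d (y ∷ ys) with ℕ.⊓-sel (f y) (foldr _⊓_ d (map f ys))
    ... | inj₁ min≡fy   = inj₂ (y , min≡fy)
    ... | inj₂ min≡rest with foldr-⊓-attained d ys
    ...   | inj₁ rest≡d        = inj₁ (trans min≡rest rest≡d)
    ...   | inj₂ (x , rest≡fx) = inj₂ (x , trans min≡rest rest≡fx)

  foldr-⊔-mono : ∀ {A : Set} {f g : A → ℕ} → (∀ x → f x ≤ g x) → ∀ xs →
                 foldr _⊔_ 0 (map f xs) ≤ foldr _⊔_ 0 (map g xs)
  foldr-⊔-mono f≤g []       = z≤n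
  foldr-⊔-mono f≤g (y ∷ ys) = ℕ.⊔-mono-≤ (f≤g y) (foldr-⊔-mono f≤g ys)

  module _ {n : ℕ} where

    maxOver-≥ : ∀ (f : Fin n → ℕ) v → f v ≤ maxOver f
    maxOver-≥ f v = foldr-⊔-≥ f (allFin n) (∈-allFin v)

    maxOver-mono : ∀ {f g : Fin n → ℕ} → (∀ v → f v ≤ g v) → maxOver f ≤ maxOver g
    maxOver-mono f≤g = foldr-⊔-mono f≤g (allFin n)

    -- minIn A f unfolds to minOver g for a g built from a helper local to Defs,
    -- which cannot be named here.  The minOver lemmas are therefore stated for
    -- any m ≡ minOver g, so that g is found by unification from `refl`.
    minOver-≤ : ∀ {m} {g : Fin n → ℕ} → m ≡ minOver g → ∀ v → m ≤ g v
    minOver-≤ {g = g} refl v = foldr-⊓-≤ g n (allFin n) (∈-allFin v)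

    minOver-≤-default : ∀ {m} {g : Fin n → ℕ} → m ≡ minOver g → m ≤ n
    minOver-≤-default {g = g} refl = foldr-⊓-≤-default g n (allFin n)

    minOver-attained : ∀ {m} {g : Fin n → ℕ} → m ≡ minOver g → m ≡ n ⊎ ∃[ v ] m ≡ g v
    minOver-attained {g = g} refl = foldr-⊓-attained g n (allFin n)

    minIn-≤ : ∀ (A : Subset n) (f : Fin n → ℕ) {v} → v ∈ A → minIn A f ≤ f v
    minIn-≤ A f {v} v∈A with lookup A v | []=⇒lookup v∈A | minOver-≤ {m = minIn A f} refl v
    ... | .inside | refl | min≤ = min≤

    minIn-attained : ∀ (A : Subset n) (f : Fin n → ℕ) → minIn A f ≡ n ⊎ ∃[ v ] v ∈ A × minIn A f ≡ f v
    minIn-attained A f with minOver-attained {m = minIn A f} refl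
    ... | inj₁ min≡n = inj₁ min≡n
    ... | inj₂ (v , min≡) with lookup A v in look
    ...   | inside  = inj₂ (v , lookup⇒[]= v A look , min≡)
    ...   | outside = inj₁ min≡

    minIn-mono : ∀ (A : Subset n) {f g : Fin n → ℕ} → (∀ v → f v ≤ g v) → minIn A f ≤ minIn A g
    minIn-mono A {f} {g} f≤g with minIn-attained A g
    ... | inj₁ min≡n = subst (minIn A f ≤_) (sym min≡n) (minOver-≤-default {m = minIn A f} refl)
    ... | inj₂ (v , v∈A , min≡gv) = subst (minIn A f ≤_) (sym min≡gv) (ℕ.≤-trans (minIn-≤ A f v∈A) (f≤g v))

  nin-closed : ∀ {n} {G : Graph n} {a ℓ S} → IsNin G a ℓ S →
               ∀ {y u} → y ∈ S → dist G u a < dist G y a → u ∈ S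
  nin-closed {S = S} (_ , closest) {y} {u} y∈S closer with u ∈? S
  ... | yes u∈S = u∈S
  ... | no  u∉S = contradiction (closest y u y∈S u∉S) (ℕ.<⇒≱ closer)

  -- Truncated subtraction followed by adding back: (m ∸ n) + n = max(m, n).
  ∸-+-≤ : ∀ m n {e} → m ≤ e → n ≤ e → m ∸ n + n ≤ e
  ∸-+-≤ m n {e} m≤e n≤e with ℕ.≤-total n m
  ... | inj₁ n≤m = subst (_≤ e) (sym (ℕ.m∸n+n≡m n≤m)) m≤e
  ... | inj₂ m≤n = subst (λ d → d + n ≤ e) (sym (ℕ.m≤n⇒m∸n≡0 m≤n)) n≤e

  -- Let H be a strongly connected common subgraph of G and
  -- G₀, let S = N^in_{G₀}(a,ℓ) and y ∈ S.  Then from every x the set S is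
  -- reachable in G within InEcc_H(a) + 1 - d_{G₀}(y,a) steps: walking a
  -- shortest H-path from x towards a, the vertex d_{G₀}(y,a) - 1 steps before a
  -- is closer to a than y, hence lies in S.
  cover-bound : ∀ {n} {H G G₀ : Graph n} → StronglyConnected H → StronglyConnected G₀ →
                H ⊆ₑ G → H ⊆ₑ G₀ → ∀ {a ℓ S} → IsNin G₀ a ℓ S → ∀ {y} → y ∈ S →
                ∀ x → distTo G x S + dist G₀ y a ≤ suc (InEcc H a)
  cover-bound {H = H} {G} {G₀} scH sc₀ H⊆G H⊆G₀ {a} {S = S} nin {y} y∈S x = bound (dist G₀ y a) refl
    where
    E = InEcc H a

    ecc-≥ : ∀ v → dist H v a ≤ E
    ecc-≥ = maxOver-≥ (λ v → dist H v a)

    distTo-≤ : ∀ {u} → u ∈ S → distTo G x S ≤ dist H x u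
    distTo-≤ {u} u∈S = ℕ.≤-trans (minIn-≤ S (dist G x) u∈S) (dist-⊆ scH H⊆G x u)

    bound : ∀ r → dist G₀ y a ≡ r → distTo G x S + r ≤ suc E
    bound zero d≡0 =
      ℕ.m≤n⇒m≤1+n (subst (_≤ E) (sym (ℕ.+-identityʳ _))
        (ℕ.≤-trans (distTo-≤ (subst (_∈ S) (dist≡0⇒≡ sc₀ d≡0) y∈S)) (ecc-≥ x)))
    bound (suc r′) d≡ with waypoint scH x a r′
    ... | u , x→u , u→a = begin
      distTo G x S + suc r′        ≤⟨ ℕ.+-monoˡ-≤ (suc r′) (ℕ.≤-trans (distTo-≤ u∈S) x→u) ⟩
      dist H x a ∸ r′ + suc r′     ≡⟨ ℕ.+-suc (dist H x a ∸ r′) r′ ⟩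
      suc (dist H x a ∸ r′ + r′)   ≤⟨ s≤s (∸-+-≤ (dist H x a) r′ (ecc-≥ x) r′≤E) ⟩
      suc E                        ∎
      where
      open ℕ.≤-Reasoning
      u∈S : u ∈ S
      u∈S = nin-closed nin y∈S (subst (dist G₀ u a <_) (sym d≡) (s≤s (ℕ.≤-trans (dist-⊆ scH H⊆G₀ u a) u→a)))
      r′≤E : r′ ≤ E
      r′≤E = ℕ.≤-trans (ℕ.n≤1+n r′) (subst (_≤ E) d≡ (ℕ.≤-trans (dist-⊆ scH H⊆G₀ y a) (ecc-≥ y)))

  mono-refl : ∀ {n} mode {A : Graph n} → MonoStep mode A A
  mono-refl insertions u v e = e
  mono-refl deletions  u v e = e

  mono-trans : ∀ {n} mode {A B C : Graph n} → MonoStep mode A B → MonoStep mode B C → MonoStep mode A C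
  mono-trans insertions A⊆B B⊆C u v e = B⊆C u v (A⊆B u v e)
  mono-trans deletions  B⊆A C⊆B u v e = B⊆A u v (C⊆B u v e)

  monotone-over : ∀ {n} mode {G : ℕ → Graph n} → Dynamic mode G →
                  ∀ {t₀ t} → t₀ ≤′ t → MonoStep mode (G t₀) (G t)
  monotone-over mode dyn ≤′-refl                = mono-refl mode
  monotone-over mode dyn (≤′-step {t} t₀≤t) =
    mono-trans mode (monotone-over mode dyn t₀≤t) (Dynamic.monotone dyn t)

  -- The sparser of the graphs `old` (at t₀) and `new` (at t ≥ t₀).
  sparser : ∀ {n} → Mode → Graph n → Graph n → Graph n
  sparser insertions old new = old
  sparser deletions  old new = new

  sparser-sc : ∀ {n} mode {G : ℕ → Graph n} → Dynamic mode G → ∀ t₀ t →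
               StronglyConnected (sparser mode (G t₀) (G t))
  sparser-sc insertions dyn t₀ t = Dynamic.stronglyConnected dyn t₀
  sparser-sc deletions  dyn t₀ t = Dynamic.stronglyConnected dyn t

  sparser-⊆-old : ∀ {n} mode {G : ℕ → Graph n} → Dynamic mode G → ∀ {t₀ t} → t₀ ≤ t →
                  sparser mode (G t₀) (G t) ⊆ₑ G t₀
  sparser-⊆-old insertions dyn t₀≤t u v e = e
  sparser-⊆-old deletions  dyn t₀≤t     = monotone-over deletions dyn (ℕ.≤⇒≤′ t₀≤t)

  sparser-⊆-new : ∀ {n} mode {G : ℕ → Graph n} → Dynamic mode G → ∀ {t₀ t} → t₀ ≤ t →
                  sparser mode (G t₀) (G t) ⊆ₑ G t
  sparser-⊆-new insertions dyn t₀≤t     = monotone-over insertions dyn (ℕ.≤⇒≤′ t₀≤t)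
  sparser-⊆-new deletions  dyn t₀≤t u v e = e

  distFrom-⊆ : ∀ {n} {H G : Graph n} → StronglyConnected H → H ⊆ₑ G →
               ∀ A x → distFrom G A x ≤ distFrom H A x
  distFrom-⊆ sc H⊆G A x = minIn-mono A (λ v → dist-⊆ sc H⊆G v x)

  maxDistFrom-⊆ : ∀ {n} {H G : Graph n} → StronglyConnected H → H ⊆ₑ G →
                  ∀ A → maxDistFrom G A ≤ maxDistFrom H A
  maxDistFrom-⊆ sc H⊆G A = maxOver-mono (distFrom-⊆ sc H⊆G A)

module Arithmetic where

  open import Defs using (ℕtoℚ)
  open import Data.Nat as ℕ using (ℕ; zero; suc; z≤n; s≤s)
  import Data.Nat.Properties as ℕ
  import Data.Nat.Coprimality as Coprime
  open import Data.Integer as ℤ using (+_; 0ℤ)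
  import Data.Integer.Properties as ℤ
  import Data.Integer.DivMod as ℤ
  open import Data.Rational
  open import Data.Rational.Properties
  open import Data.Rational.Solver using (module +-*-Solver)
  open import Data.Empty using (⊥-elim)
  open import Relation.Nullary using (yes; no)
  open import Relation.Binary.PropositionalEquality using (_≡_; refl; sym; trans; cong; subst; subst₂)

  open +-*-Solver

  ℕtoℚ-normal : ∀ k → ℕtoℚ k ≡ mkℚ (+ k) 0 (Coprime.sym (Coprime.1-coprimeTo k))
  ℕtoℚ-normal k = normalize-coprime (Coprime.sym (Coprime.1-coprimeTo k))

  ℕtoℚ-mono : ∀ {a b} → a ℕ.≤ b → ℕtoℚ a ≤ ℕtoℚ b
  ℕtoℚ-mono {a} {b} a≤b rewrite ℕtoℚ-normal a | ℕtoℚ-normal b =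
    *≤* (ℤ.*-monoʳ-≤-nonNeg (+ 1) (ℤ.+≤+ a≤b))

  ℕtoℚ-+ : ∀ a b → ℕtoℚ (a ℕ.+ b) ≡ ℕtoℚ a + ℕtoℚ b
  ℕtoℚ-+ a b rewrite ℕtoℚ-normal a | ℕtoℚ-normal b
                   | ℕ.*-identityʳ a | ℕ.*-identityʳ b | ℤ.+◃n≡+n a | ℤ.+◃n≡+n b = refl

  ℕtoℚ-nonNeg : ∀ a → 0ℚ ≤ ℕtoℚ a
  ℕtoℚ-nonNeg a = ℕtoℚ-mono {0} {a} z≤n

  ≤-/ : ∀ i n d → i ℤ.* + suc d ℤ.≤ n → i ℤ.≤ n ℤ./ + suc d
  ≤-/ i n d i*D≤n with i ℤ.≤? n ℤ./ + suc d
  ... | yes i≤q = i≤q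
  ... | no  i≰q = ⊥-elim (ℤ.<-irrefl refl (ℤ.<-≤-trans n<sq*D (ℤ.≤-trans sq*D≤i*D i*D≤n)))
    where
    q = n ℤ./ + suc d
    n<sq*D : n ℤ.< ℤ.suc q ℤ.* + suc d
    n<sq*D = subst (λ q → n ℤ.< ℤ.suc q ℤ.* + suc d) (sym (ℤ.div-pos-is-/ℕ n (suc d))) (ℤ.n<s[n/ℕd]*d n (suc d))
    sq*D≤i*D : ℤ.suc q ℤ.* + suc d ℤ.≤ i ℤ.* + suc d
    sq*D≤i*D = ℤ.*-monoʳ-≤-nonNeg (+ suc d) (ℤ.i<j⇒suc[i]≤j (ℤ.≰⇒> i≰q))

  /-< : ∀ i n d → n ℤ.< i ℤ.* + suc d → n ℤ./ + suc d ℤ.< i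
  /-< i n d n<i*D = ℤ.*-cancelʳ-<-nonNeg (+ suc d) (ℤ.≤-<-trans (ℤ.[n/d]*d≤n n (+ suc d)) n<i*D)

  floor-≥ : ∀ k z → ℕtoℚ k ≤ z → + k ℤ.≤ floor z
  floor-≥ k (mkℚ m d c) k≤z rewrite ℕtoℚ-normal k =
    ≤-/ (+ k) m d (subst (+ k ℤ.* + suc d ℤ.≤_) (ℤ.*-identityʳ m) (drop-*≤* k≤z))

  ceiling-normal : ∀ m d .(c : Coprime.Coprime ℤ.∣ m ∣ (suc d)) → ceiling (mkℚ m d c) ≡ ℤ.- ((ℤ.- m) ℤ./ + suc d)
  ceiling-normal ℤ.-[1+ n ] d c = refl
  ceiling-normal (+ zero)   d c = refl
  ceiling-normal (+ suc n)  d c = refl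

  ceiling-cross : ∀ i m d .(c : Coprime.Coprime ℤ.∣ m ∣ (suc d)) → i ℤ.* + suc d ℤ.< m → ℤ.suc i ℤ.≤ ceiling (mkℚ m d c)
  ceiling-cross i m d c i*D<m rewrite ceiling-normal m d c =
    ℤ.i<j⇒suc[i]≤j (subst (ℤ._< ℤ.- q) (ℤ.neg-involutive i) (ℤ.neg-mono-< q<-i))
    where
    q = (ℤ.- m) ℤ./ + suc d
    q<-i : q ℤ.< ℤ.- i
    q<-i = /-< (ℤ.- i) (ℤ.- m) d
             (subst (ℤ.- m ℤ.<_) (ℤ.neg-distribˡ-* i (+ suc d)) (ℤ.neg-mono-< i*D<m))

  ceiling-> : ∀ k z → ℕtoℚ k < z → + suc k ℤ.≤ ceiling z
  ceiling-> k (mkℚ m d c) k<z rewrite ℕtoℚ-normal k =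
    ceiling-cross (+ k) m d c (subst (+ k ℤ.* + suc d ℤ.<_) (ℤ.*-identityʳ m) (drop-*<* k<z))

  ceiling-≥0 : ∀ z → 0ℚ ≤ z → + 0 ℤ.≤ ceiling z
  ceiling-≥0 (mkℚ m d c) 0≤z =
    ceiling-cross ℤ.-1ℤ m d c (ℤ.<-≤-trans ℤ.-<+ (subst (0ℤ ℤ.≤_) (ℤ.*-identityʳ m) (drop-*≤* 0≤z)))

  +-cancelʳ-< : ∀ {x y} r → x + r < y + r → x < y
  +-cancelʳ-< {x} {y} r x+r<y+r = subst₂ _<_ (cancel x) (cancel y) (+-monoˡ-< (- r) x+r<y+r)
    where
    cancel : ∀ w → w + r - r ≡ w
    cancel w = solve 2 (λ w r → w :+ r :- r := w) refl w r

  ceiling-from-budget : ∀ d r E z → 0ℚ ≤ z → d ℕ.+ r ℕ.≤ suc E → ℕtoℚ E < ℕtoℚ r + z →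
                        + d ℤ.≤ ceiling z
  ceiling-from-budget zero    r E z 0≤z _            _      = ceiling-≥0 z 0≤z
  ceiling-from-budget (suc d) r E z _   (s≤s d+r≤E) E<r+z = ceiling-> d z (+-cancelʳ-< (ℕtoℚ r) (begin-strict
    ℕtoℚ d + ℕtoℚ r  ≡⟨ ℕtoℚ-+ d r ⟨
    ℕtoℚ (d ℕ.+ r)   ≤⟨ ℕtoℚ-mono d+r≤E ⟩
    ℕtoℚ E           <⟨ E<r+z ⟩
    ℕtoℚ r + z       ≡⟨ +-comm (ℕtoℚ r) z ⟩
    z + ℕtoℚ r       ∎))
    where open ≤-Reasoning

  ≥0-* : ∀ {a b} → 0ℚ ≤ a → 0ℚ ≤ b → 0ℚ ≤ a * b
  ≥0-* {a} {b} 0≤a 0≤b = subst (_≤ a * b) (*-zeroʳ a) (*-monoˡ-≤-nonNeg a {{nonNegative 0≤a}} 0≤b)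

  ≥0-+ : ∀ {a b} → 0ℚ ≤ a → 0ℚ ≤ b → 0ℚ ≤ a + b
  ≥0-+ = +-mono-≤

  ≥0-- : ∀ {a b} → a ≤ b → 0ℚ ≤ b - a
  ≥0-- {a} {b} a≤b = subst (_≤ b - a) (+-inverseʳ a) (+-monoˡ-≤ (- a) a≤b)

  ≤-surplus : ∀ {x y s} → 0ℚ ≤ s → x ≡ y + s → y ≤ x
  ≤-surplus {x} {y} 0≤s x≡y+s = subst₂ _≤_ (+-identityʳ y) (sym x≡y+s) (+-monoʳ-≤ y 0≤s)

  complement : ∀ {p q} → p + q ≡ 1ℚ → p ≡ 1ℚ - q
  complement {p} {q} p+q≡1 = trans (solve 2 (λ p q → p := p :+ q :- q) refl p q) (cong (_- q) p+q≡1)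

  two : ℚ
  two = ℕtoℚ 2

  module _ {ε : ℚ} (0≤ε : 0ℚ ≤ ε) (ε≤½ : ε ≤ ½) where

    1-ε>0 : 0ℚ < 1ℚ - ε
    1-ε>0 = <-≤-trans {0ℚ} {1ℚ - ½} (*<* (ℤ.+<+ (s≤s z≤n))) (+-monoʳ-≤ 1ℚ (neg-antimono-≤ ε≤½))

    1+ε>0 : 0ℚ < 1ℚ + ε
    1+ε>0 = <-≤-trans {0ℚ} {1ℚ} (*<* (ℤ.+<+ (s≤s z≤n))) (≤-surplus 0≤ε refl)

    -- Deletions.  If ℓ ≤ (1+ε)ℓ₀ ≤ (1+ε)r/(1−ε) and (p+2ε)D < ℓ, then
    -- D < r + (q+2ε)D; multiplied by 1+ε this is the sum of
    -- (1+ε)D ≤ (1−ε)(p+2ε)D + (1+ε)(q+2ε)D and (1−ε)(p+2ε)D < (1+ε)r.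
    deletion-budget : ∀ p q ℓ₀ ℓ r D → 0ℚ ≤ q → p + q ≡ 1ℚ → 0ℚ ≤ D →
      ℓ ≤ ℓ₀ * (1ℚ + ε) → (1ℚ - ε) * ℓ₀ ≤ r → (p + two * ε) * D < ℓ → D < r + (q + two * ε) * D
    deletion-budget p q ℓ₀ ℓ r D 0≤q p+q≡1 0≤D ℓ≤ r≥ c₁D<ℓ =
      *-cancelˡ-<-nonNeg A (begin-strict
        A * D                          ≤⟨ ≤-surplus surplus≥0 split ⟩
        B * (c₁ * D) + A * (c₂ * D)    <⟨ +-monoˡ-< (A * (c₂ * D)) Bc₁D<Ar ⟩
        A * r + A * (c₂ * D)           ≡⟨ *-distribˡ-+ A r (c₂ * D) ⟨
        A * (r + c₂ * D)               ∎)
      where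
      open ≤-Reasoning
      A B c₁ c₂ : ℚ
      A = 1ℚ + ε
      B = 1ℚ - ε
      c₁ = p + two * ε
      c₂ = q + two * ε
      instance
        A≥0 : NonNegative A
        A≥0 = nonNegative (<⇒≤ 1+ε>0)
        B≥0 : NonNegative B
        B≥0 = nonNegative (<⇒≤ 1-ε>0)
        B>0 : Positive B
        B>0 = positive 1-ε>0
      surplus≥0 : 0ℚ ≤ ε * ((two + two * q) * D)
      surplus≥0 = ≥0-* 0≤ε (≥0-* (≥0-+ (ℕtoℚ-nonNeg 2) (≥0-* (ℕtoℚ-nonNeg 2) 0≤q)) 0≤D)
      split : B * (c₁ * D) + A * (c₂ * D) ≡ A * D + ε * ((two + two * q) * D)
      split = trans (cong (λ p → B * ((p + two * ε) * D) + A * (c₂ * D)) (complement {p} {q} p+q≡1))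
        (solve 3 (λ e q D → (con 1ℚ :- e) :* (((con 1ℚ :- q) :+ con two :* e) :* D) :+ (con 1ℚ :+ e) :* ((q :+ con two :* e) :* D)
                         := (con 1ℚ :+ e) :* D :+ e :* ((con two :+ con two :* q) :* D)) refl ε q D)
      Bc₁D<Ar : B * (c₁ * D) < A * r
      Bc₁D<Ar = begin-strict
        B * (c₁ * D)   <⟨ *-monoʳ-<-pos B c₁D<ℓ ⟩
        B * ℓ          ≤⟨ *-monoˡ-≤-nonNeg B ℓ≤ ⟩
        B * (ℓ₀ * A)   ≡⟨ solve 3 (λ b l a → b :* (l :* a) := a :* (b :* l)) refl B ℓ₀ A ⟩
        A * (B * ℓ₀)   ≤⟨ *-monoˡ-≤-nonNeg A r≥ ⟩
        A * r          ∎

    -- If ℓ ≤ ℓ₀ ≤ r/(1−ε), (p+2ε)D < ℓ and (1−ε)E ≤ D, then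
    -- E < r + (q+2ε)D; multiplied by 1−ε this follows from
    -- D ≤ (1−ε)²(p+2ε)D + (1−ε)(q+2ε)D  (as ε ≤ ½)  and  (1−ε)²(p+2ε)D < (1−ε)r.
    insertion-budget : ∀ p q ℓ₀ ℓ r D E → 0ℚ ≤ q → p + q ≡ 1ℚ → 0ℚ ≤ D →
      ℓ ≤ ℓ₀ → ℓ₀ * (1ℚ - ε) ≤ r → (p + two * ε) * D < ℓ → (1ℚ - ε) * E ≤ D →
      E < r + (q + two * ε) * D
    insertion-budget p q ℓ₀ ℓ r D E 0≤q p+q≡1 0≤D ℓ≤ℓ₀ r≥ c₁D<ℓ BE≤D =
      *-cancelˡ-<-nonNeg B (begin-strict
        B * E                                ≤⟨ BE≤D ⟩
        D                                    ≤⟨ ≤-surplus surplus≥0 split ⟩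
        B * (B * (c₁ * D)) + B * (c₂ * D)    <⟨ +-monoˡ-< (B * (c₂ * D)) BBc₁D<Br ⟩
        B * r + B * (c₂ * D)                 ≡⟨ *-distribˡ-+ B r (c₂ * D) ⟨
        B * (r + c₂ * D)                     ∎)
      where
      open ≤-Reasoning
      B c₁ c₂ : ℚ
      B = 1ℚ - ε
      c₁ = p + two * ε
      c₂ = q + two * ε
      instance
        B≥0 : NonNegative B
        B≥0 = nonNegative (<⇒≤ 1-ε>0)
        B>0 : Positive B
        B>0 = positive 1-ε>0
      ε≤two : ε ≤ two
      ε≤two = ≤-trans ε≤½ (*≤* (ℤ.+≤+ (s≤s z≤n)))
      two·ε≤1 : two * ε ≤ 1ℚ
      two·ε≤1 = *-monoˡ-≤-nonNeg two {{nonNegative (ℕtoℚ-nonNeg 2)}} ε≤½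
      surplus : ℚ
      surplus = ε * ((two - ε) * ((1ℚ - two * ε) * D)) + B * (ε * (q * D))
      surplus≥0 : 0ℚ ≤ surplus
      surplus≥0 = ≥0-+ (≥0-* 0≤ε (≥0-* (≥0-- ε≤two) (≥0-* (≥0-- two·ε≤1) 0≤D)))
                       (≥0-* (<⇒≤ 1-ε>0) (≥0-* 0≤ε (≥0-* 0≤q 0≤D)))
      split : B * (B * (c₁ * D)) + B * (c₂ * D) ≡ D + surplus
      split = trans (cong (λ p → B * (B * ((p + two * ε) * D)) + B * (c₂ * D)) (complement {p} {q} p+q≡1))
        (solve 3 (λ e q D → (con 1ℚ :- e) :* ((con 1ℚ :- e) :* (((con 1ℚ :- q) :+ con two :* e) :* D)) :+ (con 1ℚ :- e) :* ((q :+ con two :* e) :* D)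
                   := D :+ (e :* ((con two :- e) :* ((con 1ℚ :- con two :* e) :* D)) :+ (con 1ℚ :- e) :* (e :* (q :* D)))) refl ε q D)
      BBc₁D<Br : B * (B * (c₁ * D)) < B * r
      BBc₁D<Br = begin-strict
        B * (B * (c₁ * D))   <⟨ *-monoʳ-<-pos B (*-monoʳ-<-pos B c₁D<ℓ) ⟩
        B * (B * ℓ)          ≤⟨ *-monoˡ-≤-nonNeg B (*-monoˡ-≤-nonNeg B ℓ≤ℓ₀) ⟩
        B * (B * ℓ₀)         ≡⟨ cong (B *_) (*-comm B ℓ₀) ⟩
        B * (ℓ₀ * B)         ≤⟨ *-monoˡ-≤-nonNeg B r≥ ⟩
        B * r                ∎

open import Defs
open import Data.Nat using (ℕ; _≤_)
open import Data.Fin using (Fin)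
open import Data.Fin.Subset using (Subset; _∩_; Nonempty; _∈_)
open import Data.Integer using (+_) renaming (_≤_ to _≤ℤ_)
open import Data.Rational using (ℚ; 0ℚ; 1ℚ; ½; floor; ceiling; _+_; _-_; _*_) renaming (_≤_ to _≤ℚ_; _<_ to _<ℚ_)
open import Data.Sum using (_⊎_; inj₁; inj₂)
open import Relation.Binary.PropositionalEquality using (_≡_; refl)
open import Data.Product using (_,_; proj₁; proj₂)
open import Data.Fin.Subset.Properties using (x∈p∩q⁻)
open import Data.Rational.Properties using (_≤?_; ≤-trans; <⇒≤; ≰⇒>)
open import Relation.Nullary using (yes; no)
import Data.Nat.Properties as ℕ

open Graphs
open Arithmetic

radius-dichotomy : ∀ {n} {dF : Fin n → ℕ} {ℓ : ℕ} {c : ℚ} {Q : Set} →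
                   (∀ x → dF x ≤ ℓ) → (c <ℚ ℕtoℚ ℓ → Q) → (∀ x → + dF x ≤ℤ floor c) ⊎ Q
radius-dichotomy {ℓ = ℓ} {c} dF≤ℓ far with ℕtoℚ ℓ ≤? c
... | yes ℓ≤c = inj₁ (λ x → floor-≥ _ c (≤-trans (ℕtoℚ-mono (dF≤ℓ x)) ℓ≤c))
... | no  ℓ≰c = inj₂ (far (≰⇒> ℓ≰c))

-- When the first alternative fails, i.e. (p+2ε)D < ℓ for D = InEcc_t(a) and
-- ℓ = max_v d_t(S₁,v), the in-eccentricity of a in the sparser of G_{t₀}, G_t
-- exceeds r = d_{t₀}(y,a), for any y ∈ S₁, by less than (q+2ε)D.  Here
-- d_{t₀}(S₁,a) ≤ r; under deletions D is that eccentricity itself, under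
-- insertions distances only shrink, so ℓ ≤ ℓ₀ and d_t(S₁,a) ≤ r.
eccentricity-budget : ∀ {n} mode (G : ℕ → Graph n) → Dynamic mode G → (S₁ : Subset n) →
    ∀ {t₀ t} → t₀ ≤ t → ∀ a {y} → y ∈ S₁ → ∀ {ε} → 0ℚ ≤ℚ ε → ε ≤ℚ ½ →
    let ℓ₀ = ℕtoℚ (maxDistFrom (G t₀) S₁)
        ℓ  = ℕtoℚ (maxDistFrom (G t) S₁)
        D  = ℕtoℚ (InEcc (G t) a) in
    ℓ ≤ℚ ℓ₀ * (1ℚ + ε) → ℓ₀ * (1ℚ - ε) ≤ℚ ℕtoℚ (distFrom (G t) S₁ a) →
    (mode ≡ deletions → (1ℚ - ε) * ℓ₀ ≤ℚ ℕtoℚ (distFrom (G t₀) S₁ a)) →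
    (mode ≡ insertions → (1ℚ - ε) * ℕtoℚ (InEcc (G t₀) a) ≤ℚ D) →
    ∀ p q → 0ℚ ≤ℚ q → p + q ≡ 1ℚ → (p + ℕtoℚ 2 * ε) * D <ℚ ℓ →
    ℕtoℚ (InEcc (sparser mode (G t₀) (G t)) a) <ℚ ℕtoℚ (dist (G t₀) y a) + (q + ℕtoℚ 2 * ε) * D
eccentricity-budget deletions G _ S₁ {t₀} {t} _ a y∈S₁ 0≤ε ε≤½ ℓ-upper _ deletion-hyp _ p q 0≤q p+q≡1 c₁D<ℓ =
  deletion-budget 0≤ε ε≤½ p q _ _ _ _ 0≤q p+q≡1 (ℕtoℚ-nonNeg (InEcc (G t) a)) ℓ-upper
    (≤-trans (deletion-hyp refl) (ℕtoℚ-mono (minIn-≤ S₁ (λ v → dist (G t₀) v a) y∈S₁))) c₁D<ℓ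
eccentricity-budget insertions G dyn S₁ {t₀} {t} t₀≤t a y∈S₁ 0≤ε ε≤½ _ a-lower _ insertion-hyp p q 0≤q p+q≡1 c₁D<ℓ =
  insertion-budget 0≤ε ε≤½ p q _ _ _ _ _ 0≤q p+q≡1 (ℕtoℚ-nonNeg (InEcc (G t) a))
    (ℕtoℚ-mono (maxDistFrom-⊆ sc₀ G₀⊆Gₜ S₁))
    (≤-trans a-lower (ℕtoℚ-mono (ℕ.≤-trans (distFrom-⊆ sc₀ G₀⊆Gₜ S₁ a)
                                           (minIn-≤ S₁ (λ v → dist (G t₀) v a) y∈S₁))))
    c₁D<ℓ (insertion-hyp refl)
  where
  sc₀ : StronglyConnected (G t₀)
  sc₀ = Dynamic.stronglyConnected dyn t₀
  G₀⊆Gₜ : G t₀ ⊆ₑ G t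
  G₀⊆Gₜ = sparser-⊆-new insertions dyn t₀≤t

lemma17 : ∀ {n : ℕ} (mode : Mode) (G : ℕ → Graph n) → Dynamic mode G →
    (S₁ : Subset n) (t₀ t : ℕ) → t₀ ≤ t → (a : Fin n) (n_q : ℕ) (S₂ : Subset n) →
    IsNin (G t₀) a n_q S₂ →
    (ε : ℚ) → 0ℚ ≤ℚ ε → ε ≤ℚ ½ →
    let ℓ₀ = ℕtoℚ (maxDistFrom (G t₀) S₁) in
    ℓ₀ * (1ℚ - ε) ≤ℚ ℕtoℚ (maxDistFrom (G t) S₁) →
    ℕtoℚ (maxDistFrom (G t) S₁) ≤ℚ ℓ₀ * (1ℚ + ε) →
    ℓ₀ * (1ℚ - ε) ≤ℚ ℕtoℚ (distFrom (G t) S₁ a) →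
    ℕtoℚ (distFrom (G t) S₁ a) ≤ℚ ℓ₀ * (1ℚ + ε) →
    Nonempty (S₁ ∩ S₂) →
    (mode ≡ deletions → (1ℚ - ε) * ℓ₀ ≤ℚ ℕtoℚ (distFrom (G t₀) S₁ a)) →
    (mode ≡ insertions →
      (1ℚ - ε) * ℕtoℚ (InEcc (G t₀) a) ≤ℚ ℕtoℚ (InEcc (G t) a)) →
    (p q : ℚ) → 0ℚ <ℚ p → 0ℚ <ℚ q → p + q ≡ 1ℚ →
    (∀ (x : Fin n) → + distFrom (G t) S₁ x ≤ℤ floor ((p + ℕtoℚ 2 * ε) * ℕtoℚ (InEcc (G t) a)))
    ⊎ (∀ (x : Fin n) → + distTo (G t) x S₂ ≤ℤ ceiling ((q + ℕtoℚ 2 * ε) * ℕtoℚ (InEcc (G t) a)))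
lemma17 mode G dyn S₁ t₀ t t₀≤t a _ S₂ nin ε 0≤ε ε≤½ _ ℓ-upper a-lower _ (y , y∈S₁∩S₂)
        deletion-hyp insertion-hyp p q _ 0<q p+q≡1 =
  radius-dichotomy (maxOver-≥ (distFrom (G t) S₁)) λ c₁D<ℓ x →
    ceiling-from-budget (distTo (G t) x S₂) (dist (G t₀) y a) _ c₂D c₂D≥0
      (cover-bound (sparser-sc mode dyn t₀ t) (Dynamic.stronglyConnected dyn t₀)
        (sparser-⊆-new mode dyn t₀≤t) (sparser-⊆-old mode dyn t₀≤t) nin y∈S₂ x)
      (eccentricity-budget mode G dyn S₁ t₀≤t a y∈S₁ 0≤ε ε≤½ ℓ-upper a-lower
        deletion-hyp insertion-hyp p q (<⇒≤ 0<q) p+q≡1 c₁D<ℓ)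
  where
  y∈S₁ : y ∈ S₁
  y∈S₁ = proj₁ (x∈p∩q⁻ S₁ S₂ y∈S₁∩S₂)
  y∈S₂ : y ∈ S₂
  y∈S₂ = proj₂ (x∈p∩q⁻ S₁ S₂ y∈S₁∩S₂)
  c₂D : ℚ
  c₂D = (q + ℕtoℚ 2 * ε) * ℕtoℚ (InEcc (G t) a)
  c₂D≥0 : 0ℚ ≤ℚ c₂D
  c₂D≥0 = ≥0-* (≥0-+ (<⇒≤ 0<q) (≥0-* (ℕtoℚ-nonNeg 2) 0≤ε)) (ℕtoℚ-nonNeg (InEcc (G t) a))
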